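{- Every read-once Boolean formula $\Phi$ whose gates all have arity at most $k$ has an equivalent $k$-$x$-basic formula $\Phi'$ (possibly using a different set of gate functions), where equivalent means $\sigma(\Phi)=\sigma(\Phi')$ for every assignment $\sigma:X\to\{0,1\}$.
   Context: A read-once Boolean formula $\Phi$ is a rooted directed tree whose leaves are labeled by variables from a set $X$ or by constants $0,1$, each variable labeling at most one leaf, and whose every internal vertex is labeled by a Boolean function of arity equal to its number of children (children ordered); $\sigma(\Phi)$ is the value at the root computed bottom-up from an assignment $\sigma:X\to\{0,1\}$. For a Boolean function $f$, input coordinate $i$ is $(a,b)$-forceful if $f(y)=b$ for every input $y$ with $y_i=a$; a gate is unforceable if none of its coordinates is $(a,b)$-forceful for any $a,b\in\{0,1\}$. A read-once formula is $k$-$x$-basic if: it is Boolean; every leaf is labeled by a variable (no constants); every internal gate is either a negation whose child is a leaf, or $\wedge$ or $\vee$ of arity at least $2$, or an unforceable function of arity between $2$ and $k$; no $\wedge$ gate has a $\wedge$ child and no $\vee$ gate has a $\vee$ child; and every variable appears in at most one leaf (either positively or under a negation). -}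

module Defs where

open import Data.Nat using (ℕ; zero; suc; _≤_)
open import Data.Bool using (Bool; true; false; not; _∧_; _∨_)
open import Data.Fin using (Fin)
open import Data.Vec using (Vec; []; _∷_; lookup; head)
open import Data.Vec.Relation.Unary.All using (All)
open import Data.List using (List; []; _∷_; _++_)
open import Data.List.Relation.Unary.Unique.Propositional using (Unique)
open import Data.Product using (Σ; _×_)
open import Relation.Binary.PropositionalEquality using (_≡_)
open import Relation.Nullary using (¬_)
open import Data.Empty using (⊥)
open import Data.Unit using (⊤)

data Formula (X : Set) : Set where
  var   : X → Formula X
  const : Bool → Formula X
  gate  : (n : ℕ) → (Vec Bool n → Bool) → Vec (Formula X) n → Formula X

module _ {X : Set} where

  mutual
    eval : (X → Bool) → Formula X → Bool
    eval σ (var x)       = σ x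
    eval σ (const b)     = b
    eval σ (gate n f cs) = f (evalV σ cs)

    evalV : (X → Bool) → ∀ {n} → Vec (Formula X) n → Vec Bool n
    evalV σ []       = []
    evalV σ (c ∷ cs) = eval σ c ∷ evalV σ cs

  mutual
    vars : Formula X → List X
    vars (var x)       = x ∷ []
    vars (const b)     = []
    vars (gate n f cs) = varsV cs

    varsV : ∀ {n} → Vec (Formula X) n → List X
    varsV []       = []
    varsV (c ∷ cs) = vars c ++ varsV cs

  ReadOnce : Formula X → Set
  ReadOnce Φ = Unique (vars Φ)

  data GatesArity≤ (k : ℕ) : Formula X → Set where
    ga-var   : ∀ {x} → GatesArity≤ k (var x)
    ga-const : ∀ {b} → GatesArity≤ k (const b)
    ga-gate  : ∀ {n f cs} → n ≤ k → All (GatesArity≤ k) cs → GatesArity≤ k (gate n f cs)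

andV : ∀ {n} → Vec Bool n → Bool
andV []       = true
andV (b ∷ bs) = b ∧ andV bs

orV : ∀ {n} → Vec Bool n → Bool
orV []       = false
orV (b ∷ bs) = b ∨ orV bs

Forceful : ∀ {n} → (Vec Bool n → Bool) → Fin n → Bool → Bool → Set
Forceful f i a b = ∀ y → lookup y i ≡ a → f y ≡ b

Unforceable : ∀ {n} → (Vec Bool n → Bool) → Set
Unforceable {n} f = ∀ (i : Fin n) (a b : Bool) → ¬ Forceful f i a b

IsNegFn : (Vec Bool 1 → Bool) → Set
IsNegFn f = ∀ y → f y ≡ not (head y)

IsAndFn : ∀ {n} → (Vec Bool n → Bool) → Set
IsAndFn f = ∀ y → f y ≡ andV y

IsOrFn : ∀ {n} → (Vec Bool n → Bool) → Set
IsOrFn f = ∀ y → f y ≡ orV y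

module _ {X : Set} where

  IsAndGate : Formula X → Set
  IsAndGate (gate n f cs) = IsAndFn f
  IsAndGate _             = ⊥

  IsOrGate : Formula X → Set
  IsOrGate (gate n f cs) = IsOrFn f
  IsOrGate _             = ⊥

  data BasicShape (k : ℕ) : Formula X → Set where
    bs-var   : ∀ {x} → BasicShape k (var x)
    bs-neg   : ∀ {f x} → IsNegFn f → BasicShape k (gate 1 f (var x ∷ []))
    bs-and   : ∀ {n f cs} → 2 ≤ n → IsAndFn f →
               All (λ c → BasicShape k c × ¬ IsAndGate c) cs → BasicShape k (gate n f cs)
    bs-or    : ∀ {n f cs} → 2 ≤ n → IsOrFn f →
               All (λ c → BasicShape k c × ¬ IsOrGate c) cs → BasicShape k (gate n f cs)
    bs-unf   : ∀ {n f cs} → 2 ≤ n → n ≤ k → Unforceable f →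
               All (BasicShape k) cs → BasicShape k (gate n f cs)

  KXBasic : ℕ → Formula X → Set
  KXBasic k Φ = BasicShape k Φ × ReadOnce Φ

module Submission where

-- Idea: normalise bottom-up.  A gate on already normalised children is reduced
-- by induction on its arity: an (a,b)-forceful coordinate i is split off by the
-- Shannon expansion "if childᵢ = a then b else g|ᵢ₌¬ₐ", which is an ∧ or ∨ with
-- a possibly negated child; a constant child is substituted into the gate;
-- otherwise the gate is unforceable, hence of arity ≥ 2, and is kept.

open import Defs
open import Data.Nat using (ℕ; zero; suc; _≤_; s≤s; z≤n)
open import Data.Nat.Properties using (≤-trans; n≤1+n; +-mono-≤)
open import Data.Bool using (Bool; true; false; not; _∧_; _∨_)
open import Data.Bool.Properties
  using (∧-isCommutativeMonoid; ∨-isCommutativeMonoid; not-involutive) renaming (_≟_ to _≟ᵇ_)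
open import Data.Fin using (Fin; zero; suc)
open import Data.Fin.Properties using (any?)
open import Data.Vec using (Vec; []; _∷_; lookup; head; map; fromList; replicate; insertAt; removeAt)
open import Data.Vec.Properties using (lookup-map; insertAt-removeAt)
open import Data.Vec.Relation.Unary.All using (All; []; _∷_)
open import Data.Vec.Relation.Unary.All.Properties using (fromList⁺)
open import Data.List as List using (List; []; _∷_; _++_; length; concatMap; foldr)
open import Data.List.Properties using (length-++; concatMap-++; ++-identityʳ; ++-assoc; map-++)
open import Data.List.Relation.Unary.All as ListAll using ([]; _∷_)
import Data.List.Relation.Unary.All.Properties as ListAll
open import Data.List.Relation.Unary.AllPairs using ([]; _∷_)
open import Data.List.Relation.Unary.Unique.Propositional using (Unique)
open import Data.List.Relation.Binary.Permutation.Propositional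
  using (_↭_; ↭-refl; ↭-trans; ↭-sym; ↭-reflexive; ↭⇒↭ₛ)
open import Data.List.Relation.Binary.Permutation.Propositional.Properties
  using (++⁺; ++⁺ˡ; ++-comm; shifts)
open import Data.List.Relation.Binary.Permutation.Setoid.Properties using (Unique-resp-↭)
open import Algebra.Structures using (IsCommutativeMonoid)
open import Data.Product using (Σ; _×_; _,_; ∃)
open import Data.Sum using (_⊎_; inj₁; inj₂)
open import Data.Empty using (⊥; ⊥-elim)
open import Relation.Binary.PropositionalEquality
  using (_≡_; refl; sym; trans; cong; cong₂; subst; setoid; module ≡-Reasoning)
open import Relation.Nullary using (¬_; Dec; yes; no)
open import Relation.Nullary.Decidable using (_→-dec_)
open ≡-Reasoning

private
  variable
    n : ℕ

select : Bool → Bool → Bool → Bool → Bool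
select true  b true  y = b
select true  b false y = y
select false b true  y = y
select false b false y = b

select-intro : ∀ {s} a b x y → (x ≡ a → s ≡ b) → (x ≡ not a → s ≡ y) → s ≡ select a b x y
select-intro true  b true  y if-a if-not-a = if-a refl
select-intro true  b false y if-a if-not-a = if-not-a refl
select-intro false b true  y if-a if-not-a = if-not-a refl
select-intro false b false y if-a if-not-a = if-a refl

restrict : (Vec Bool (suc n) → Bool) → Fin (suc n) → Bool → Vec Bool n → Bool
restrict g i c z = g (insertAt z i c)

restrict-removeAt : ∀ (g : Vec Bool (suc n) → Bool) y i {c} → lookup y i ≡ c →
  g y ≡ restrict g i c (removeAt y i)
restrict-removeAt g y i refl = cong g (sym (insertAt-removeAt y i))

forceful-expansion : ∀ {g : Vec Bool (suc n) → Bool} {i a b} → Forceful g i a b →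
  ∀ y → g y ≡ select a b (lookup y i) (restrict g i (not a) (removeAt y i))
forceful-expansion {g = g} {i} {a} {b} forceful y =
  select-intro a b (lookup y i) _ (forceful y) (restrict-removeAt g y i)

Forceable : (Vec Bool n → Bool) → Set
Forceable {n} g = Σ (Fin n) λ i → Σ Bool λ a → Σ Bool λ b → Forceful g i a b

all-vectors? : ∀ n {P : Vec Bool n → Set} → (∀ y → Dec (P y)) → Dec (∀ y → P y)
all-vectors? zero    P? with P? []
... | yes p = yes λ { [] → p }
... | no ¬p = no λ all → ¬p (all [])
all-vectors? (suc n) P? with all-vectors? n (λ ys → P? (true ∷ ys)) | all-vectors? n (λ ys → P? (false ∷ ys))
... | yes pt | yes pf = yes λ { (true ∷ ys) → pt ys ; (false ∷ ys) → pf ys }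
... | no ¬pt | _      = no λ all → ¬pt (λ ys → all (true ∷ ys))
... | yes _  | no ¬pf = no λ all → ¬pf (λ ys → all (false ∷ ys))

some-bool? : {P : Bool → Set} → Dec (P true) → Dec (P false) → Dec (Σ Bool P)
some-bool? (yes p) _       = yes (true , p)
some-bool? (no _)  (yes p) = yes (false , p)
some-bool? (no ¬t) (no ¬f) = no λ { (true , p) → ¬t p ; (false , p) → ¬f p }

forceable? : (g : Vec Bool n → Bool) → Dec (Forceable g)
forceable? {n} g = any? λ i → some-bool? (forceful-to? i true) (forceful-to? i false)
  where
  forceful-to? : ∀ i a → Dec (Σ Bool λ b → Forceful g i a b)
  forceful-to? i a = some-bool? (decide true) (decide false)
    where
    decide : ∀ b → Dec (Forceful g i a b)
    decide b = all-vectors? n (λ y → (lookup y i ≟ᵇ a) →-dec (g y ≟ᵇ b))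

-- Every unary gate is forceful, so unforceable gates never have arity 1.
unary-forceable : (g : Vec Bool 1 → Bool) → Forceful g zero true (g (true ∷ []))
unary-forceable g (true ∷ []) refl = refl

unforceable-not : ∀ {f : Vec Bool n → Bool} → Unforceable f → Unforceable (λ y → not (f y))
unforceable-not {f = f} unforceable i a b forceful =
  unforceable i a (not b) λ y yi≡a → trans (sym (not-involutive (f y))) (cong not (forceful y yi≡a))

-- Conjunction and disjunction, treated uniformly

data Junction : Set where
  conj disj : Junction

dual : Junction → Junction
dual conj = disj
dual disj = conj

junction : Junction → Bool → Bool → Bool
junction conj = _∧_
junction disj = _∨_

-- the identity element of the junction; its negation is absorbing
unit : Junction → Bool
unit conj = true
unit disj = false

junction-isCommutativeMonoid : ∀ j → IsCommutativeMonoid _≡_ (junction j) (unit j)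
junction-isCommutativeMonoid conj = ∧-isCommutativeMonoid
junction-isCommutativeMonoid disj = ∨-isCommutativeMonoid

module JunctionLaws (j : Junction) = IsCommutativeMonoid (junction-isCommutativeMonoid j)

junction-deMorgan : ∀ j x y → not (junction j x y) ≡ junction (dual j) (not x) (not y)
junction-deMorgan conj true  y = refl
junction-deMorgan conj false y = refl
junction-deMorgan disj true  y = refl
junction-deMorgan disj false y = refl

junctionV : Junction → Vec Bool n → Bool
junctionV conj = andV
junctionV disj = orV

junctionL : Junction → List Bool → Bool
junctionL j = foldr (junction j) (unit j)

junctionL-++ : ∀ j (bs cs : List Bool) → junctionL j (bs ++ cs) ≡ junction j (junctionL j bs) (junctionL j cs)
junctionL-++ j []       cs = sym (JunctionLaws.identityˡ j _)
junctionL-++ j (b ∷ bs) cs = begin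
  junction j b (junctionL j (bs ++ cs))                        ≡⟨ cong (junction j b) (junctionL-++ j bs cs) ⟩
  junction j b (junction j (junctionL j bs) (junctionL j cs))  ≡⟨ JunctionLaws.assoc j b _ _ ⟨
  junction j (junction j b (junctionL j bs)) (junctionL j cs)  ∎

IsJunctionFn : Junction → (Vec Bool n → Bool) → Set
IsJunctionFn j f = ∀ y → f y ≡ junctionV j y

junctionV-forceful : ∀ j → Forceful (junctionV {suc n} j) zero (not (unit j)) (not (unit j))
junctionV-forceful conj (false ∷ y) refl = refl
junctionV-forceful disj (true  ∷ y) refl = refl

unforceable-not-junction : ∀ j {f : Vec Bool (suc n) → Bool} → Unforceable f → ¬ IsJunctionFn j f
unforceable-not-junction j unforceable is-j =
  unforceable zero (not (unit j)) (not (unit j)) λ y y₀ → trans (is-j y) (junctionV-forceful j y y₀)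

junctions-differ : ∀ j → 2 ≤ n → ¬ IsJunctionFn (dual j) (junctionV {n} j)
junctions-differ conj (s≤s (s≤s {n = m} _)) same with same (true ∷ false ∷ replicate m false)
... | ()
junctions-differ disj (s≤s (s≤s {n = m} _)) same with same (true ∷ false ∷ replicate m false)
... | ()

notFn : Vec Bool 1 → Bool
notFn y = not (head y)

notFn-not-junction : ∀ j → ¬ IsJunctionFn j notFn
notFn-not-junction conj same with same (true ∷ [])
... | ()
notFn-not-junction disj same with same (false ∷ [])
... | ()

-- Sub-multisets of lists: xs ⊑ ys when xs extended by some list is a
-- permutation of ys.  Duplicate-freeness passes down along ⊑.

module _ {A : Set} where

  infix 4 _⊑_
  _⊑_ : List A → List A → Set
  xs ⊑ ys = ∃ λ zs → xs ++ zs ↭ ys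

  ↭⇒⊑ : ∀ {xs ys} → xs ↭ ys → xs ⊑ ys
  ↭⇒⊑ {xs} p = [] , ↭-trans (↭-reflexive (++-identityʳ xs)) p

  ⊑-refl : ∀ {xs} → xs ⊑ xs
  ⊑-refl = ↭⇒⊑ ↭-refl

  []⊑ : ∀ xs → [] ⊑ xs
  []⊑ xs = xs , ↭-refl

  suffix-⊑ : ∀ xs ys → ys ⊑ xs ++ ys
  suffix-⊑ xs ys = xs , ++-comm ys xs

  ⊑-trans : ∀ {xs ys zs} → xs ⊑ ys → ys ⊑ zs → xs ⊑ zs
  ⊑-trans {xs} (rest₁ , p) (rest₂ , q) =
    rest₁ ++ rest₂ , ↭-trans (↭-reflexive (sym (++-assoc xs rest₁ rest₂))) (↭-trans (++⁺ p ↭-refl) q)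

  ⊑-++ : ∀ {xs ys xs′ ys′} → xs ⊑ ys → xs′ ⊑ ys′ → xs ++ xs′ ⊑ ys ++ ys′
  ⊑-++ {xs} {_} {xs′} (rest , p) (rest′ , p′) = rest ++ rest′ , ↭-trans regroup (++⁺ p p′)
    where
    regroup : (xs ++ xs′) ++ rest ++ rest′ ↭ (xs ++ rest) ++ xs′ ++ rest′
    regroup = ↭-trans (↭-reflexive (++-assoc xs xs′ _))
              (↭-trans (++⁺ˡ xs (shifts xs′ rest))
                       (↭-reflexive (sym (++-assoc xs rest _))))

  unique-prefix : ∀ xs {ys : List A} → Unique (xs ++ ys) → Unique xs
  unique-prefix []       _                  = []
  unique-prefix (x ∷ xs) (x∉rest ∷ unique) = ListAll.++⁻ˡ xs x∉rest ∷ unique-prefix xs unique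

  ⊑-unique : ∀ {xs ys} → xs ⊑ ys → Unique ys → Unique xs
  ⊑-unique {xs} (rest , p) unique = unique-prefix xs (Unique-resp-↭ (setoid A) (↭⇒↭ₛ (↭-sym p)) unique)

concatMapV : {A B : Set} → (A → List B) → Vec A n → List B
concatMapV f []       = []
concatMapV f (a ∷ as) = f a ++ concatMapV f as

concatMapV-removeAt : {A B : Set} (f : A → List B) (as : Vec A (suc n)) (i : Fin (suc n)) →
  concatMapV f as ↭ f (lookup as i) ++ concatMapV f (removeAt as i)
concatMapV-removeAt f (a ∷ as)          zero    = ↭-refl
concatMapV-removeAt f (a ∷ as@(_ ∷ _)) (suc i) =
  ↭-trans (++⁺ˡ (f a) (concatMapV-removeAt f as i)) (shifts (f a) (f (lookup as i)))

map-removeAt : {A B : Set} (f : A → B) (as : Vec A (suc n)) (i : Fin (suc n)) →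
  map f (removeAt as i) ≡ removeAt (map f as) i
map-removeAt f (a ∷ as)          zero    = refl
map-removeAt f (a ∷ as@(_ ∷ _)) (suc i) = cong (f a ∷_) (map-removeAt f as i)

module NormalForms {X : Set} (k : ℕ) where

  data NF : Set where
    lit  : Bool → X → NF                      -- lit true x is x, lit false x is ¬x
    node : Junction → NF → NF → NF
    unf  : (m : ℕ) → 2 ≤ m → m ≤ k → (f : Vec Bool m → Bool) → Unforceable f → Vec NF m → NF

  mutual
    semNF : (X → Bool) → NF → Bool
    semNF σ (lit true x)        = σ x
    semNF σ (lit false x)       = not (σ x)
    semNF σ (node j a b)        = junction j (semNF σ a) (semNF σ b)
    semNF σ (unf _ _ _ f _ ts)  = f (semNFs σ ts)

    semNFs : (X → Bool) → Vec NF n → Vec Bool n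
    semNFs σ []       = []
    semNFs σ (t ∷ ts) = semNF σ t ∷ semNFs σ ts

  mutual
    varsNF : NF → List X
    varsNF (lit _ x)           = x ∷ []
    varsNF (node _ a b)        = varsNF a ++ varsNF b
    varsNF (unf _ _ _ _ _ ts)  = varsNFs ts

    varsNFs : Vec NF n → List X
    varsNFs []       = []
    varsNFs (t ∷ ts) = varsNF t ++ varsNFs ts

  negNF : NF → NF
  negNF (lit p x)                = lit (not p) x
  negNF (node j a b)             = node (dual j) (negNF a) (negNF b)
  negNF (unf m 2≤m m≤k f u ts)   = unf m 2≤m m≤k (λ y → not (f y)) (unforceable-not u) ts

  negNF-sem : ∀ σ t → semNF σ (negNF t) ≡ not (semNF σ t)
  negNF-sem σ (lit true x)        = refl
  negNF-sem σ (lit false x)       = sym (not-involutive (σ x))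
  negNF-sem σ (node j a b)        = begin
    junction (dual j) (semNF σ (negNF a)) (semNF σ (negNF b))
      ≡⟨ cong₂ (junction (dual j)) (negNF-sem σ a) (negNF-sem σ b) ⟩
    junction (dual j) (not (semNF σ a)) (not (semNF σ b))
      ≡⟨ junction-deMorgan j _ _ ⟨
    not (junction j (semNF σ a) (semNF σ b)) ∎
  negNF-sem σ (unf _ _ _ _ _ ts)  = refl

  negNF-vars : ∀ t → varsNF (negNF t) ≡ varsNF t
  negNF-vars (lit p x)           = refl
  negNF-vars (node j a b)        = cong₂ _++_ (negNF-vars a) (negNF-vars b)
  negNF-vars (unf _ _ _ _ _ ts)  = refl

  -- Translation to formulas: maximal chains of equal junctions become one
  -- n-ary ∧/∨-gate whose operands are the translations of the chain's ends.
  mutual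
    toFormula : NF → Formula X
    toFormula (lit true x)        = var x
    toFormula (lit false x)       = gate 1 notFn (var x ∷ [])
    toFormula (node j a b)        = gate _ (junctionV j) (fromList (operands j a ++ operands j b))
    toFormula (unf m _ _ f _ ts)  = gate m f (toFormulas ts)

    operands : Junction → NF → List (Formula X)
    operands j    (lit p x)             = toFormula (lit p x) ∷ []
    operands j    (unf m p q f u ts)    = toFormula (unf m p q f u ts) ∷ []
    operands conj (node conj a b)       = operands conj a ++ operands conj b
    operands disj (node disj a b)       = operands disj a ++ operands disj b
    operands conj (node disj a b)       = toFormula (node disj a b) ∷ []
    operands disj (node conj a b)       = toFormula (node conj a b) ∷ []

    toFormulas : Vec NF n → Vec (Formula X) n
    toFormulas []       = []
    toFormulas (t ∷ ts) = toFormula t ∷ toFormulas ts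

  junctionV-evalV : ∀ σ j (φs : List (Formula X)) →
    junctionV j (evalV σ (fromList φs)) ≡ junctionL j (List.map (eval σ) φs)
  junctionV-evalV σ conj []       = refl
  junctionV-evalV σ conj (φ ∷ φs) = cong (eval σ φ ∧_) (junctionV-evalV σ conj φs)
  junctionV-evalV σ disj []       = refl
  junctionV-evalV σ disj (φ ∷ φs) = cong (eval σ φ ∨_) (junctionV-evalV σ disj φs)

  mutual
    toFormula-sem : ∀ σ t → eval σ (toFormula t) ≡ semNF σ t
    toFormula-sem σ (lit true x)        = refl
    toFormula-sem σ (lit false x)       = refl
    toFormula-sem σ (node j a b)        =
      trans (junctionV-evalV σ j (operands j a ++ operands j b)) (chain-sem σ j a b)
    toFormula-sem σ (unf _ _ _ f _ ts)  = cong f (toFormulas-sem σ ts)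

    chain-sem : ∀ σ j a b →
      junctionL j (List.map (eval σ) (operands j a ++ operands j b)) ≡ junction j (semNF σ a) (semNF σ b)
    chain-sem σ j a b = begin
      junctionL j (List.map (eval σ) (operands j a ++ operands j b))
        ≡⟨ cong (junctionL j) (map-++ (eval σ) (operands j a) _) ⟩
      junctionL j (List.map (eval σ) (operands j a) ++ List.map (eval σ) (operands j b))
        ≡⟨ junctionL-++ j (List.map (eval σ) (operands j a)) _ ⟩
      junction j (junctionL j (List.map (eval σ) (operands j a))) (junctionL j (List.map (eval σ) (operands j b)))
        ≡⟨ cong₂ (junction j) (operands-sem σ j a) (operands-sem σ j b) ⟩
      junction j (semNF σ a) (semNF σ b) ∎

    operands-sem : ∀ σ j t → junctionL j (List.map (eval σ) (operands j t)) ≡ semNF σ t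
    operands-sem σ j    (lit p x)          = single-sem σ j (lit p x)
    operands-sem σ j    (unf m p q f u ts) = single-sem σ j (unf m p q f u ts)
    operands-sem σ conj (node conj a b)    = chain-sem σ conj a b
    operands-sem σ disj (node disj a b)    = chain-sem σ disj a b
    operands-sem σ conj (node disj a b)    = single-sem σ conj (node disj a b)
    operands-sem σ disj (node conj a b)    = single-sem σ disj (node conj a b)

    single-sem : ∀ σ j t → junctionL j (List.map (eval σ) (toFormula t ∷ [])) ≡ semNF σ t
    single-sem σ j t = trans (JunctionLaws.identityʳ j _) (toFormula-sem σ t)

    toFormulas-sem : ∀ σ (ts : Vec NF n) → evalV σ (toFormulas ts) ≡ semNFs σ ts
    toFormulas-sem σ []       = refl
    toFormulas-sem σ (t ∷ ts) = cong₂ _∷_ (toFormula-sem σ t) (toFormulas-sem σ ts)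

  varsV-fromList : ∀ (φs : List (Formula X)) → varsV (fromList φs) ≡ concatMap vars φs
  varsV-fromList []       = refl
  varsV-fromList (φ ∷ φs) = cong (vars φ ++_) (varsV-fromList φs)

  mutual
    toFormula-vars : ∀ t → vars (toFormula t) ≡ varsNF t
    toFormula-vars (lit true x)        = refl
    toFormula-vars (lit false x)       = refl
    toFormula-vars (node j a b)        = trans (varsV-fromList (operands j a ++ operands j b)) (chain-vars j a b)
    toFormula-vars (unf _ _ _ _ _ ts)  = toFormulas-vars ts

    chain-vars : ∀ j a b → concatMap vars (operands j a ++ operands j b) ≡ varsNF a ++ varsNF b
    chain-vars j a b = trans (concatMap-++ vars (operands j a) _) (cong₂ _++_ (operands-vars j a) (operands-vars j b))

    operands-vars : ∀ j t → concatMap vars (operands j t) ≡ varsNF t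
    operands-vars j    (lit p x)          = single-vars (lit p x)
    operands-vars j    (unf m p q f u ts) = single-vars (unf m p q f u ts)
    operands-vars conj (node conj a b)    = chain-vars conj a b
    operands-vars disj (node disj a b)    = chain-vars disj a b
    operands-vars conj (node disj a b)    = single-vars (node disj a b)
    operands-vars disj (node conj a b)    = single-vars (node conj a b)

    single-vars : ∀ t → concatMap vars (toFormula t ∷ []) ≡ varsNF t
    single-vars t = trans (++-identityʳ _) (toFormula-vars t)

    toFormulas-vars : ∀ (ts : Vec NF n) → varsV (toFormulas ts) ≡ varsNFs ts
    toFormulas-vars []       = refl
    toFormulas-vars (t ∷ ts) = cong₂ _++_ (toFormula-vars t) (toFormulas-vars ts)

  mutual
    operands-nonempty : ∀ j t → 1 ≤ length (operands j t)
    operands-nonempty j    (lit p x)          = s≤s z≤n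
    operands-nonempty j    (unf m p q f u ts) = s≤s z≤n
    operands-nonempty conj (node conj a b)    = ≤-trans (n≤1+n 1) (chain-length conj a b)
    operands-nonempty disj (node disj a b)    = ≤-trans (n≤1+n 1) (chain-length disj a b)
    operands-nonempty conj (node disj a b)    = s≤s z≤n
    operands-nonempty disj (node conj a b)    = s≤s z≤n

    chain-length : ∀ j a b → 2 ≤ length (operands j a ++ operands j b)
    chain-length j a b = subst (2 ≤_) (sym (length-++ (operands j a)))
                               (+-mono-≤ (operands-nonempty j a) (operands-nonempty j b))

  IsJunctionGate : Junction → Formula X → Set
  IsJunctionGate j (gate _ f _) = IsJunctionFn j f
  IsJunctionGate j _            = ⊥

  Operand : Junction → Formula X → Set
  Operand j φ = BasicShape k φ × ¬ IsJunctionGate j φ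

  conj-operand : ∀ {φ} → Operand conj φ → BasicShape k φ × ¬ IsAndGate φ
  conj-operand {var _}      (shape , _) = shape , λ ()
  conj-operand {const _}    (shape , _) = shape , λ ()
  conj-operand {gate _ _ _} operand     = operand

  disj-operand : ∀ {φ} → Operand disj φ → BasicShape k φ × ¬ IsOrGate φ
  disj-operand {var _}      (shape , _) = shape , λ ()
  disj-operand {const _}    (shape , _) = shape , λ ()
  disj-operand {gate _ _ _} operand     = operand

  mutual
    toFormula-shape : ∀ t → BasicShape k (toFormula t)
    toFormula-shape (lit true x)                = bs-var
    toFormula-shape (lit false x)               = bs-neg (λ _ → refl)
    toFormula-shape (node conj a b)             =
      bs-and (chain-length conj a b) (λ _ → refl)
             (fromList⁺ (ListAll.map conj-operand (chain-shape conj a b)))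
    toFormula-shape (node disj a b)             =
      bs-or (chain-length disj a b) (λ _ → refl)
            (fromList⁺ (ListAll.map disj-operand (chain-shape disj a b)))
    toFormula-shape (unf _ 2≤m m≤k _ u ts)      = bs-unf 2≤m m≤k u (toFormulas-shape ts)

    chain-shape : ∀ j a b → ListAll.All (Operand j) (operands j a ++ operands j b)
    chain-shape j a b = ListAll.++⁺ (operands-shape j a) (operands-shape j b)

    operands-shape : ∀ j t → ListAll.All (Operand j) (operands j t)
    operands-shape j    (lit true x)        = (bs-var , λ ()) ∷ []
    operands-shape j    (lit false x)       = (bs-neg (λ _ → refl) , notFn-not-junction j) ∷ []
    operands-shape j    t@(unf _ (s≤s _) _ _ u _) = (toFormula-shape t , unforceable-not-junction j u) ∷ []
    operands-shape conj (node conj a b)     = chain-shape conj a b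
    operands-shape disj (node disj a b)     = chain-shape disj a b
    operands-shape conj (node disj a b)     =
      (toFormula-shape (node disj a b) , junctions-differ disj (chain-length disj a b)) ∷ []
    operands-shape disj (node conj a b)     =
      (toFormula-shape (node conj a b) , junctions-differ conj (chain-length conj a b)) ∷ []

    toFormulas-shape : ∀ (ts : Vec NF n) → All (BasicShape k) (toFormulas ts)
    toFormulas-shape []       = []
    toFormulas-shape (t ∷ ts) = toFormula-shape t ∷ toFormulas-shape ts

  toFormula-basic : ∀ t → Unique (varsNF t) → KXBasic k (toFormula t)
  toFormula-basic t unique = toFormula-shape t , subst Unique (sym (toFormula-vars t)) unique

  Normal : Set
  Normal = Bool ⊎ NF

  semN : (X → Bool) → Normal → Bool
  semN σ (inj₁ c) = c
  semN σ (inj₂ t) = semNF σ t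

  varsN : Normal → List X
  varsN (inj₁ _) = []
  varsN (inj₂ t) = varsNF t

  varsNs : Vec Normal n → List X
  varsNs = concatMapV varsN

  negN : Normal → Normal
  negN (inj₁ c) = inj₁ (not c)
  negN (inj₂ t) = inj₂ (negNF t)

  negN-sem : ∀ σ r → semN σ (negN r) ≡ not (semN σ r)
  negN-sem σ (inj₁ c) = refl
  negN-sem σ (inj₂ t) = negNF-sem σ t

  negN-vars : ∀ r → varsN (negN r) ≡ varsN r
  negN-vars (inj₁ c) = refl
  negN-vars (inj₂ t) = negNF-vars t

  joinConst : Junction → Bool → Normal → Normal
  joinConst conj true  r = r
  joinConst conj false r = inj₁ false
  joinConst disj true  r = inj₁ true
  joinConst disj false r = r

  joinConst-sem : ∀ σ j c r → semN σ (joinConst j c r) ≡ junction j c (semN σ r)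
  joinConst-sem σ conj true  r = refl
  joinConst-sem σ conj false r = refl
  joinConst-sem σ disj true  r = refl
  joinConst-sem σ disj false r = refl

  joinConst-vars : ∀ j c r → varsN (joinConst j c r) ⊑ varsN r
  joinConst-vars conj true  r = ⊑-refl
  joinConst-vars conj false r = []⊑ (varsN r)
  joinConst-vars disj true  r = []⊑ (varsN r)
  joinConst-vars disj false r = ⊑-refl

  joinN : Junction → Normal → Normal → Normal
  joinN j (inj₁ c) s        = joinConst j c s
  joinN j (inj₂ t) (inj₁ c) = joinConst j c (inj₂ t)
  joinN j (inj₂ t) (inj₂ u) = inj₂ (node j t u)

  joinN-sem : ∀ σ j r s → semN σ (joinN j r s) ≡ junction j (semN σ r) (semN σ s)
  joinN-sem σ j (inj₁ c) s        = joinConst-sem σ j c s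
  joinN-sem σ j (inj₂ t) (inj₁ c) = trans (joinConst-sem σ j c (inj₂ t)) (JunctionLaws.comm j c _)
  joinN-sem σ j (inj₂ t) (inj₂ u) = refl

  joinN-vars : ∀ j r s → varsN (joinN j r s) ⊑ varsN r ++ varsN s
  joinN-vars j (inj₁ c) s        = joinConst-vars j c s
  joinN-vars j (inj₂ t) (inj₁ c) =
    ⊑-trans (joinConst-vars j c (inj₂ t)) (↭⇒⊑ (↭-reflexive (sym (++-identityʳ _))))
  joinN-vars j (inj₂ t) (inj₂ u) = ⊑-refl

  guarded : Bool → Bool → Normal → Normal → Normal
  guarded true  true  l r = joinN disj l r
  guarded false true  l r = joinN disj (negN l) r
  guarded true  false l r = joinN conj (negN l) r
  guarded false false l r = joinN conj l r

  guarded-sem : ∀ σ a b l r → semN σ (guarded a b l r) ≡ select a b (semN σ l) (semN σ r)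
  guarded-sem σ true  true  l r rewrite joinN-sem σ disj l r with semN σ l
  ... | true  = refl
  ... | false = refl
  guarded-sem σ false true  l r rewrite joinN-sem σ disj (negN l) r | negN-sem σ l with semN σ l
  ... | true  = refl
  ... | false = refl
  guarded-sem σ true  false l r rewrite joinN-sem σ conj (negN l) r | negN-sem σ l with semN σ l
  ... | true  = refl
  ... | false = refl
  guarded-sem σ false false l r rewrite joinN-sem σ conj l r with semN σ l
  ... | true  = refl
  ... | false = refl

  guarded-vars : ∀ a b l r → varsN (guarded a b l r) ⊑ varsN l ++ varsN r
  guarded-vars true  true  l r = joinN-vars disj l r
  guarded-vars false true  l r rewrite sym (negN-vars l) = joinN-vars disj (negN l) r
  guarded-vars true  false l r rewrite sym (negN-vars l) = joinN-vars conj (negN l) r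
  guarded-vars false false l r = joinN-vars conj l r

  record Represents (s : (X → Bool) → Bool) (xs : List X) : Set where
    constructor represents
    field
      normal : Normal
      vars⊑  : varsN normal ⊑ xs
      sem    : ∀ σ → semN σ normal ≡ s σ

  applied : (Vec Bool n → Bool) → Vec Normal n → (X → Bool) → Bool
  applied g rs σ = g (map (semN σ) rs)

  removeAt-vars⊑ : ∀ {m} (rs : Vec Normal (suc m)) i → varsN (lookup rs i) ++ varsNs (removeAt rs i) ⊑ varsNs rs
  removeAt-vars⊑ rs i = ↭⇒⊑ (↭-sym (concatMapV-removeAt varsN rs i))

  split-forceful : ∀ {m} {g : Vec Bool (suc m) → Bool} {i a b} → Forceful g i a b →
    (rs : Vec Normal (suc m)) →
    Represents (applied (restrict g i (not a)) (removeAt rs i)) (varsNs (removeAt rs i)) →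
    Represents (applied g rs) (varsNs rs)
  split-forceful {g = g} {i} {a} {b} forceful rs (represents r vars⊑ sem) =
    represents (guarded a b (lookup rs i) r)
               (⊑-trans (guarded-vars a b _ r) (⊑-trans (⊑-++ ⊑-refl vars⊑) (removeAt-vars⊑ rs i)))
               sem′
    where
    sem′ : ∀ σ → semN σ (guarded a b (lookup rs i) r) ≡ applied g rs σ
    sem′ σ = begin
      semN σ (guarded a b (lookup rs i) r)
        ≡⟨ guarded-sem σ a b (lookup rs i) r ⟩
      select a b (semN σ (lookup rs i)) (semN σ r)
        ≡⟨ cong₂ (select a b) (sym (lookup-map i (semN σ) rs)) (sem σ) ⟩
      select a b (lookup y i) (restrict g i (not a) (map (semN σ) (removeAt rs i)))
        ≡⟨ cong (λ z → select a b (lookup y i) (restrict g i (not a) z)) (map-removeAt (semN σ) rs i) ⟩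
      select a b (lookup y i) (restrict g i (not a) (removeAt y i))
        ≡⟨ forceful-expansion forceful y ⟨
      g y ∎
      where y = map (semN σ) rs

  substitute-constant : ∀ {m} {g : Vec Bool (suc m) → Bool} (rs : Vec Normal (suc m)) i {c} →
    lookup rs i ≡ inj₁ c →
    Represents (applied (restrict g i c) (removeAt rs i)) (varsNs (removeAt rs i)) →
    Represents (applied g rs) (varsNs rs)
  substitute-constant {g = g} rs i {c} rsᵢ≡c (represents r vars⊑ sem) =
    represents r (⊑-trans vars⊑ (⊑-trans (suffix-⊑ (varsN (lookup rs i)) _) (removeAt-vars⊑ rs i))) sem′
    where
    sem′ : ∀ σ → semN σ r ≡ applied g rs σ
    sem′ σ = begin
      semN σ r                                       ≡⟨ sem σ ⟩
      restrict g i c (map (semN σ) (removeAt rs i))  ≡⟨ cong (restrict g i c) (map-removeAt (semN σ) rs i) ⟩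
      restrict g i c (removeAt (map (semN σ) rs) i)  ≡⟨ restrict-removeAt g _ i yᵢ≡c ⟨
      g (map (semN σ) rs)                            ∎
      where yᵢ≡c = trans (lookup-map i (semN σ) rs) (cong (semN σ) rsᵢ≡c)

  semNFs-map : ∀ σ (ts : Vec NF n) → semNFs σ ts ≡ map (semN σ) (map inj₂ ts)
  semNFs-map σ []       = refl
  semNFs-map σ (t ∷ ts) = cong (semNF σ t ∷_) (semNFs-map σ ts)

  varsNFs-map : ∀ (ts : Vec NF n) → varsNFs ts ≡ varsNs (map inj₂ ts)
  varsNFs-map []       = refl
  varsNFs-map (t ∷ ts) = cong (varsNF t ++_) (varsNFs-map ts)

  keep-unforceable : ∀ {m} → suc m ≤ k → (g : Vec Bool (suc m) → Bool) → Unforceable g →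
    (ts : Vec NF (suc m)) →
    Represents (applied g (map inj₂ ts)) (varsNs (map inj₂ ts))
  keep-unforceable {zero}  _     g unforceable _  = ⊥-elim (unforceable zero true _ (unary-forceable g))
  keep-unforceable {suc m} sm≤k g unforceable ts =
    represents (inj₂ (unf (suc (suc m)) (s≤s (s≤s z≤n)) sm≤k g unforceable ts))
               (↭⇒⊑ (↭-reflexive (varsNFs-map ts)))
               (λ σ → cong g (semNFs-map σ ts))

  constant-argument? : (rs : Vec Normal n) →
    (Σ (Fin n) λ i → Σ Bool λ c → lookup rs i ≡ inj₁ c) ⊎ (Σ (Vec NF n) λ ts → rs ≡ map inj₂ ts)
  constant-argument? []            = inj₂ ([] , refl)
  constant-argument? (inj₁ c ∷ rs) = inj₁ (zero , c , refl)
  constant-argument? (inj₂ t ∷ rs) with constant-argument? rs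
  ... | inj₁ (i , c , rsᵢ≡c) = inj₁ (suc i , c , rsᵢ≡c)
  ... | inj₂ (ts , refl)     = inj₂ (t ∷ ts , refl)

  reduce-gate : ∀ m → m ≤ k → (g : Vec Bool m → Bool) (rs : Vec Normal m) →
    Represents (applied g rs) (varsNs rs)
  reduce-gate zero    _    g [] = represents (inj₁ (g [])) ([]⊑ []) (λ σ → refl)
  reduce-gate (suc m) sm≤k g rs with forceable? g
  ... | yes (i , a , b , forceful) =
    split-forceful forceful rs (reduce-gate m m≤k (restrict g i (not a)) (removeAt rs i))
    where m≤k = ≤-trans (n≤1+n m) sm≤k
  ... | no unforceable with constant-argument? rs
  ...   | inj₁ (i , c , rsᵢ≡c) =
    substitute-constant {g = g} rs i rsᵢ≡c (reduce-gate m m≤k (restrict g i c) (removeAt rs i))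
    where m≤k = ≤-trans (n≤1+n m) sm≤k
  ...   | inj₂ (ts , refl) = keep-unforceable sm≤k g (λ i a b forceful → unforceable (i , a , b , forceful)) ts

  mutual
    normalise : (Φ : Formula X) → GatesArity≤ k Φ → Represents (λ σ → eval σ Φ) (vars Φ)
    normalise (var x)       _                     = represents (inj₂ (lit true x)) ⊑-refl (λ σ → refl)
    normalise (const b)     _                     = represents (inj₁ b) ([]⊑ []) (λ σ → refl)
    normalise (gate m f Φs) (ga-gate m≤k bounded) with normaliseAll Φs bounded
    ... | rs , rs-vars⊑ , rs-sem with reduce-gate m m≤k f rs
    ...   | represents r vars⊑ sem =
      represents r (⊑-trans vars⊑ rs-vars⊑) (λ σ → trans (sem σ) (cong f (rs-sem σ)))

    normaliseAll : (Φs : Vec (Formula X) n) → All (GatesArity≤ k) Φs →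
      Σ (Vec Normal n) λ rs → varsNs rs ⊑ varsV Φs × (∀ σ → map (semN σ) rs ≡ evalV σ Φs)
    normaliseAll []       []                 = [] , ⊑-refl , λ σ → refl
    normaliseAll (Φ ∷ Φs) (bounded ∷ bounded′) with normalise Φ bounded | normaliseAll Φs bounded′
    ... | represents r vars⊑ sem | rs , rs-vars⊑ , rs-sem =
      r ∷ rs , ⊑-++ vars⊑ rs-vars⊑ , λ σ → cong₂ _∷_ (sem σ) (rs-sem σ)

open NormalForms using (represents; normalise; toFormula; toFormula-basic; toFormula-sem)

lemma2p13 : {X : Set} (k : ℕ) (Φ : Formula X) → ReadOnce Φ → GatesArity≤ k Φ →
            (Σ Bool (λ b → ∀ (σ : X → Bool) → eval σ Φ ≡ b))
            ⊎ (Σ (Formula X) (λ Φ′ → KXBasic k Φ′ × (∀ (σ : X → Bool) → eval σ Φ ≡ eval σ Φ′)))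
lemma2p13 k Φ read-once bounded with normalise k Φ bounded
... | represents (inj₁ b) _     sem = inj₁ (b , λ σ → sym (sem σ))
... | represents (inj₂ t) vars⊑ sem =
  inj₂ (toFormula k t , toFormula-basic k t (⊑-unique vars⊑ read-once) ,
        λ σ → trans (sym (sem σ)) (sym (toFormula-sem k σ t)))
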